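{- Let $r\ge 1$, let $s\ge 2$ be even, and let $k=rs\ge 2$. Let $G(8,2)$ be the graph obtained from $s$ disjoint copies of $C(8,2)$, indexed $1,\dots,s$, by merging, for each $1\le i\le s/2$, the vertex $z$ of copy $i$ with the vertex $u_4$ of copy $s/2+i$, and the vertex $z$ of copy $s/2+i$ with the vertex $u_4$ of copy $i$. Then $\chi_{la}(rG(8,2))=3$.
   Context: For a graph $G=(V,E)$ with $|E|=m$ and no isolated vertices, a local antimagic labeling is a bijection $f:E\to\{1,\dots,m\}$ such that $f^+(u)\ne f^+(v)$ for every edge $uv$, where $f^+(x)=\sum f(e)$ over all edges $e$ incident to $x$. The local antimagic chromatic number $\chi_{la}(G)$ is the minimum, over all local antimagic labelings $f$ of $G$, of the number of distinct values taken by $f^+$ (also for disconnected graphs). $rG$ is the disjoint union of $r$ copies of $G$. Merging vertices means identifying them into one vertex incident to all edges previously incident to any of them. $C(8,2)$ is the graph with vertices $u_1,\dots,u_7,z$ consisting of the 8-cycle $u_1u_2\cdots u_7zu_1$ together with the extra edges $zu_2$ and $zu_6$ (equivalently: an 8-cycle $u_1\cdots u_8u_1$ plus a vertex $x$ adjacent to $u_2,u_6$, with $x$ and $u_8$ then merged into $z$). -}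

module Defs where

open import Data.Nat using (ℕ; zero; suc; _+_; _*_; _∸_; _≤_; _<ᵇ_; _≡ᵇ_; _≟_)
open import Data.Bool using (Bool; if_then_else_; _∨_)
open import Data.Fin using (Fin; toℕ)
open import Data.List using (List; []; _∷_; length; lookup; map; upTo; allFin; concatMap; deduplicate)
open import Data.Nat.ListAction using (sum)
open import Data.Product using (_×_; _,_; Σ; proj₁; proj₂)
open import Function.Bundles using (_⤖_; Bijection)
open import Relation.Binary.PropositionalEquality using (_≡_; _≢_)

-- A finite graph: vertices are the naturals 0 .. nV-1, edges are listed
-- (edge number i, i < length E, joins the two given endpoints).
record Graph : Set where
  constructor graph
  field
    nV : ℕ
    E  : List (ℕ × ℕ)
open Graph public

nE : Graph → ℕ
nE G = length (E G)

-- edge labelings: bijections from the edges onto {1,...,m}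
-- (edge i gets label 1 + toℕ (f i)).
Labeling : Graph → Set
Labeling G = Fin (nE G) ⤖ Fin (nE G)

label : (G : Graph) → Labeling G → Fin (nE G) → ℕ
label G f i = suc (toℕ (Bijection.to f i))

incident : ℕ × ℕ → ℕ → Bool
incident (a , b) v = (a ≡ᵇ v) ∨ (b ≡ᵇ v)

vsum : (G : Graph) → Labeling G → ℕ → ℕ
vsum G f v = sum (map (λ i → if incident (lookup (E G) i) v then label G f i else 0)
                      (allFin (nE G)))

IsLocalAntimagic : (G : Graph) → Labeling G → Set
IsLocalAntimagic G f =
  (i : Fin (nE G)) → vsum G f (proj₁ (lookup (E G) i)) ≢ vsum G f (proj₂ (lookup (E G) i))

numColors : (G : Graph) → Labeling G → ℕ
numColors G f = length (deduplicate _≟_ (map (vsum G f) (upTo (nV G))))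

χla≡ : Graph → ℕ → Set
χla≡ G k =
  (Σ (Labeling G) λ f → IsLocalAntimagic G f × numColors G f ≡ k)
  × ((f : Labeling G) → IsLocalAntimagic G f → k ≤ numColors G f)

copies : ℕ → Graph → Graph
copies r G = graph (r * nV G)
  (concatMap (λ c → map (λ e → (c * nV G + proj₁ e , c * nV G + proj₂ e)) (E G)) (upTo r))

-- C(8,2) in local numbering: u_t is t (1 ≤ t ≤ 7), z is 0.
-- Edges: the 8-cycle u1 u2 ... u7 z u1 plus z u2 and z u6.
C82-edges : List (ℕ × ℕ)
C82-edges = (1 , 2) ∷ (2 , 3) ∷ (3 , 4) ∷ (4 , 5) ∷ (5 , 6) ∷ (6 , 7) ∷ (7 , 0)
          ∷ (0 , 1) ∷ (0 , 2) ∷ (0 , 6) ∷ []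

-- G(8,2) with s = 2h copies of C(8,2) indexed j = 0 .. 2h-1.
-- The partner of copy j is j+h (if j < h) or j-h (otherwise); the z of copy j is
-- merged with u4 of its partner copy. Vertex u_t of copy j is 7j + (t-1), so z of
-- copy j is the vertex 7 * partner j + 3.
partner : ℕ → ℕ → ℕ
partner h j = if j <ᵇ h then j + h else j ∸ h

G82-vertex : ℕ → ℕ → ℕ → ℕ
G82-vertex h j zero    = 7 * partner h j + 3
G82-vertex h j (suc t) = 7 * j + t

G82 : ℕ → Graph
G82 h = graph (7 * (2 * h))
  (concatMap (λ j → map (λ e → (G82-vertex h j (proj₁ e) , G82-vertex h j (proj₂ e))) C82-edges)
             (upTo (2 * h)))

-- Let N = r·s be the number of copies of C(8,2) and, for a copy q < N, let d = N - 1 - q.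
-- Copy q gives its edges u1u2, u2u3, u3u4, u4u5, u5u6, u6u7, u7z, zu1, zu2, zu6 the labels 1 + ℓ
-- for ℓ = q, 4N+2d+1, 2N+2q, 4N+2d, 2N+2q+1, N+d, 6N+q, 7N+d, 8N+q, 9N+d.  As q + d is fixed, all copies
-- have the same vertex sums: 8N+1 at u1, u3, u5, u7, 14N+2 at u2, u6, 8N at u4 and 32N+2 at z,
-- so every merged vertex z = u4 gets 40N+2.  These three values colour C(8,2) properly, and the
-- triangle u1 u2 z needs three colours.  The labels form a bijection because each is a
-- mixed-radix numeral: a block of width 2N, a parity or half inside it, and q or d.
module Submission where

open import Data.Bool using (Bool; true; false; if_then_else_; T)
open import Data.Fin using (Fin; toℕ; fromℕ<; punchOut; #_)
open import Data.Fin.Properties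
  using (toℕ-fromℕ<; toℕ-injective; toℕ<n; any?; punchOut-injective; injective⇒≤) renaming (_≟_ to _≟ᶠ_)
open import Data.List
  using (List; []; _∷_; _++_; length; lookup; map; tabulate; concat; concatMap; applyUpTo; upTo; deduplicate)
open import Data.List.Properties
  using ( length-++; length-map; length-removeAt′; map-tabulate; tabulate-cong; map-applyUpTo
        ; concatMap-cong; map-concatMap; map-∘)
open import Data.List.Membership.Propositional using (_∈_)
open import Data.List.Membership.Propositional.Properties
  using (∈-map⁺; ∈-map⁻; ∈-upTo⁺; ∈-upTo⁻; ∈-deduplicate⁺; ∈-deduplicate⁻; ∈-lookup)
open import Data.List.Relation.Binary.Subset.Propositional using (_⊆_)
open import Data.List.Relation.Unary.All using (All; []; _∷_; all?)
import Data.List.Relation.Unary.All as All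
import Data.List.Relation.Unary.All.Properties as All
open import Data.List.Relation.Unary.AllPairs using ([]; _∷_)
open import Data.List.Relation.Unary.Any using (here; there; _─_)
open import Data.List.Relation.Unary.Unique.Propositional using (Unique)
open import Data.Nat
open import Data.Nat.DivMod using (m≡m%n+[m/n]*n; m%n<n; m<n*o⇒m/o<n)
open import Data.Nat.ListAction using (sum)
open import Data.Nat.Properties
open import Data.Nat.Tactic.RingSolver using (solve-∀)
open import Data.List.Relation.Unary.Unique.DecPropositional.Properties _≟_ using (deduplicate-!)
open import Algebra.Properties.CommutativeSemigroup +-commutativeSemigroup using (interchange)
open import Data.Product using (_×_; _,_; proj₁; proj₂; ∃)
open import Function using (_∘_)
open import Function.Bundles using (mk⤖)
open import Function.Consequences.Propositional using (strictlySurjective⇒surjective)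
open import Function.Definitions using (Injective; Surjective)
open import Relation.Binary.Definitions using (tri<; tri≈; tri>)
open import Relation.Binary.PropositionalEquality
open import Relation.Nullary using (contradiction; yes; no; _×-dec_; ¬?)
open import Relation.Nullary.Decidable using (from-yes)

open import Defs

open ≡-Reasoning

-- Finite sums

∑< : ℕ → (ℕ → ℕ) → ℕ
∑< zero    f = 0
∑< (suc n) f = f 0 + ∑< n (f ∘ suc)

infix 5 ∑<
syntax ∑< n (λ i → f) = ∑[ i < n ] f

∑-cong : ∀ n {f g : ℕ → ℕ} → (∀ {i} → i < n → f i ≡ g i) → ∑< n f ≡ ∑< n g
∑-cong zero    f≗g = refl
∑-cong (suc n) f≗g = cong₂ _+_ (f≗g z<s) (∑-cong n (f≗g ∘ s<s))

∑-zero : ∀ n → ∑[ i < n ] 0 ≡ 0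
∑-zero zero    = refl
∑-zero (suc n) = ∑-zero n

∑-distrib-+ : ∀ n (f g : ℕ → ℕ) → ∑[ i < n ] (f i + g i) ≡ ∑< n f + ∑< n g
∑-distrib-+ zero    f g = refl
∑-distrib-+ (suc n) f g = begin
  (f 0 + g 0) + (∑[ i < n ] (f (suc i) + g (suc i)))
    ≡⟨ cong (f 0 + g 0 +_) (∑-distrib-+ n (f ∘ suc) (g ∘ suc)) ⟩
  (f 0 + g 0) + (∑< n (f ∘ suc) + ∑< n (g ∘ suc))
    ≡⟨ interchange (f 0) (g 0) _ _ ⟩
  (f 0 + ∑< n (f ∘ suc)) + (g 0 + ∑< n (g ∘ suc))
    ∎

*-distribʳ-∑ : ∀ n (f : ℕ → ℕ) c → ∑< n f * c ≡ ∑[ i < n ] (f i * c)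
*-distribʳ-∑ zero    f c = refl
*-distribʳ-∑ (suc n) f c = trans (*-distribʳ-+ c (f 0) _) (cong (f 0 * c +_) (*-distribʳ-∑ n (f ∘ suc) c))

∑-comm : ∀ m n (f : ℕ → ℕ → ℕ) → ∑[ i < m ] ∑[ j < n ] f i j ≡ ∑[ j < n ] ∑[ i < m ] f i j
∑-comm zero    n f = sym (∑-zero n)
∑-comm (suc m) n f = begin
  (∑[ j < n ] f 0 j) + (∑[ i < m ] ∑[ j < n ] f (suc i) j)  ≡⟨ cong (_ +_) (∑-comm m n (f ∘ suc)) ⟩
  (∑[ j < n ] f 0 j) + (∑[ j < n ] ∑[ i < m ] f (suc i) j)  ≡⟨ ∑-distrib-+ n (f 0) _ ⟨
  (∑[ j < n ] ∑[ i < suc m ] f i j)                        ∎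

∑∑∑-swap-factor : ∀ r m n (f : ℕ → ℕ → ℕ → ℕ) (g : ℕ → ℕ) →
  ∑[ c < r ] ∑[ j < m ] ∑[ x < n ] f c j x * g x ≡ ∑[ x < n ] (∑[ c < r ] ∑[ j < m ] f c j x) * g x
∑∑∑-swap-factor r m n f g = begin
  (∑[ c < r ] ∑[ j < m ] ∑[ x < n ] f c j x * g x)
    ≡⟨ ∑-cong r (λ {c} _ → ∑-comm m n λ j x → f c j x * g x) ⟩
  (∑[ c < r ] ∑[ x < n ] ∑[ j < m ] f c j x * g x)
    ≡⟨ ∑-comm r n (λ c x → ∑[ j < m ] f c j x * g x) ⟩
  (∑[ x < n ] ∑[ c < r ] ∑[ j < m ] f c j x * g x)
    ≡⟨ ∑-cong n (λ {x} _ → factor x) ⟨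
  (∑[ x < n ] (∑[ c < r ] ∑[ j < m ] f c j x) * g x)
    ∎
  where
  factor : ∀ x → (∑[ c < r ] ∑[ j < m ] f c j x) * g x ≡ ∑[ c < r ] ∑[ j < m ] f c j x * g x
  factor x = trans (*-distribʳ-∑ r _ (g x)) (∑-cong r λ {c} _ → *-distribʳ-∑ m (λ j → f c j x) (g x))

∑-++ : ∀ m n (f : ℕ → ℕ) → ∑< (m + n) f ≡ ∑< m f + (∑[ i < n ] f (m + i))
∑-++ zero    n f = refl
∑-++ (suc m) n f = trans (cong (f 0 +_) (∑-++ m n (f ∘ suc))) (sym (+-assoc (f 0) _ _))

∑-flatten : ∀ r m (f : ℕ → ℕ) → ∑[ c < r ] ∑[ j < m ] f (c * m + j) ≡ ∑< (r * m) f
∑-flatten zero    m f = refl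
∑-flatten (suc r) m f = begin
  ∑< m f + (∑[ c < r ] ∑[ j < m ] f (m + c * m + j))
    ≡⟨ cong (∑< m f +_) (∑-cong r λ _ → ∑-cong m λ _ → cong f (+-assoc m _ _)) ⟩
  ∑< m f + (∑[ c < r ] ∑[ j < m ] f (m + (c * m + j)))
    ≡⟨ cong (∑< m f +_) (∑-flatten r m (f ∘ (m +_))) ⟩
  ∑< m f + (∑[ i < r * m ] f (m + i))
    ≡⟨ ∑-++ m (r * m) f ⟨
  ∑< (m + r * m) f
    ∎

-- Kronecker delta and positional notation

δ : ℕ → ℕ → ℕ
δ a b = if a ≡ᵇ b then 1 else 0

δ-refl : ∀ a → δ a a ≡ 1
δ-refl zero    = refl
δ-refl (suc a) = δ-refl a

δ-≢ : ∀ {a b} → a ≢ b → δ a b ≡ 0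
δ-≢ {zero}  {zero}  a≢b = contradiction refl a≢b
δ-≢ {zero}  {suc b} a≢b = refl
δ-≢ {suc a} {zero}  a≢b = refl
δ-≢ {suc a} {suc b} a≢b = δ-≢ (a≢b ∘ cong suc)

δ-sym : ∀ a b → δ a b ≡ δ b a
δ-sym zero    zero    = refl
δ-sym zero    (suc b) = refl
δ-sym (suc a) zero    = refl
δ-sym (suc a) (suc b) = δ-sym a b

∑-δ : ∀ {n a} → a < n → (f : ℕ → ℕ) → ∑[ x < n ] δ x a * f x ≡ f a
∑-δ {suc n} {zero}  _         f =
  trans (cong (_+ _) (+-identityʳ (f 0))) (trans (cong (f 0 +_) (∑-zero n)) (+-identityʳ (f 0)))
∑-δ {suc n} {suc a} (s<s a<n) f = ∑-δ a<n (f ∘ suc)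

∑-δ≡1 : ∀ {n a} → a < n → ∑[ x < n ] δ x a ≡ 1
∑-δ≡1 {n} a<n = trans (∑-cong n λ _ → sym (*-identityʳ _)) (∑-δ a<n λ _ → 1)

digits-< : ∀ {n m a p} → a < n → p < m → a + p * n < m * n
digits-< {n} {p = p} a<n p<m = <-≤-trans (+-monoˡ-< (p * n) a<n) (*-monoˡ-≤ n p<m)

digits-unique : ∀ {n a b p q} → a < n → b < n → a + p * n ≡ b + q * n → a ≡ b × p ≡ q
digits-unique {n} {a} {b} {p} {q} a<n b<n eq with <-cmp p q
... | tri< p<q _ _  = contradiction eq (<⇒≢ (<-≤-trans (digits-< a<n p<q) (m≤n+m (q * n) b)))
... | tri> _ _ q<p  = contradiction (sym eq) (<⇒≢ (<-≤-trans (digits-< b<n q<p) (m≤n+m (p * n) a)))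
... | tri≈ _ refl _ = +-cancelʳ-≡ (p * n) a b eq , refl

digits-divMod : ∀ {n a} p → .{{_ : NonZero n}} → a < n → (a + p * n) % n ≡ a × (a + p * n) / n ≡ p
digits-divMod {n} {a} p a<n = digits-unique (m%n<n (a + p * n) n) a<n (sym (m≡m%n+[m/n]*n (a + p * n) n))

δ-digits : ∀ {n a b} p q → a < n → b < n → δ (a + p * n) (b + q * n) ≡ δ p q * δ a b
δ-digits {n} {a} {b} p q a<n b<n with p ≟ q | a ≟ b
... | yes refl | yes refl = trans (δ-refl (a + p * n)) (sym (cong₂ _*_ (δ-refl p) (δ-refl a)))
... | yes refl | no a≢b   = trans (δ-≢ (a≢b ∘ proj₁ ∘ digits-unique {p = p} {q = p} a<n b<n))
                                  (sym (trans (cong (δ p p *_) (δ-≢ a≢b)) (*-zeroʳ (δ p p))))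
... | no p≢q   | _        = trans (δ-≢ (p≢q ∘ proj₂ ∘ digits-unique {p = p} {q = q} a<n b<n))
                                  (cong (_* δ a b) (sym (δ-≢ p≢q)))

-- Incidence sums

incidenceSum : List (ℕ × ℕ) → (ℕ → ℕ) → ℕ → ℕ
incidenceSum []       w v = 0
incidenceSum (e ∷ es) w v = (if incident e v then w 0 else 0) + incidenceSum es (w ∘ suc) v

incident-δ : ∀ {a b} v w → a ≢ b → (if incident (a , b) v then w else 0) ≡ (δ a v + δ b v) * w
incident-δ {a} {b} v w a≢b with a ≡ᵇ v in a≡v | b ≡ᵇ v in b≡v
... | true  | true  =
  contradiction (trans (≡ᵇ⇒≡ a v (subst T (sym a≡v) _)) (sym (≡ᵇ⇒≡ b v (subst T (sym b≡v) _)))) a≢b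
... | true  | false = sym (+-identityʳ w)
... | false | true  = sym (+-identityʳ w)
... | false | false = refl

sum-tabulate-incident : ∀ es (w : ℕ → ℕ) v →
  sum (tabulate (λ i → if incident (lookup es i) v then w (toℕ i) else 0)) ≡ incidenceSum es w v
sum-tabulate-incident []       w v = refl
sum-tabulate-incident (e ∷ es) w v = cong (_ +_) (sum-tabulate-incident es (w ∘ suc) v)

vsum≡incidenceSum : ∀ G f (w : ℕ → ℕ) → (∀ i → label G f i ≡ w (toℕ i)) →
                    ∀ v → vsum G f v ≡ incidenceSum (E G) w v
vsum≡incidenceSum G f w label≗w v = begin
  sum (map (λ i → at i (label G f i)) (tabulate (λ i → i)))
    ≡⟨ cong sum (map-tabulate (λ i → i) (λ i → at i (label G f i))) ⟩
  sum (tabulate (λ i → at i (label G f i)))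
    ≡⟨ cong sum (tabulate-cong λ i → cong (at i) (label≗w i)) ⟩
  sum (tabulate (λ i → at i (w (toℕ i))))
    ≡⟨ sum-tabulate-incident (E G) w v ⟩
  incidenceSum (E G) w v
    ∎
  where
  at : Fin (nE G) → ℕ → ℕ
  at i l = if incident (lookup (E G) i) v then l else 0

incidenceSum-cong : ∀ es {w w' : ℕ → ℕ} v → (∀ {k} → k < length es → w k ≡ w' k) →
                    incidenceSum es w v ≡ incidenceSum es w' v
incidenceSum-cong []       v w≗w' = refl
incidenceSum-cong (e ∷ es) v w≗w' =
  cong₂ _+_ (cong (λ l → if incident e v then l else 0) (w≗w' z<s)) (incidenceSum-cong es v (w≗w' ∘ s<s))

incidenceSum-++ : ∀ xs ys w v →
  incidenceSum (xs ++ ys) w v ≡ incidenceSum xs w v + incidenceSum ys (λ k → w (length xs + k)) v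
incidenceSum-++ []       ys w v = refl
incidenceSum-++ (x ∷ xs) ys w v = trans (cong (_ +_) (incidenceSum-++ xs ys (w ∘ suc) v))
                                        (sym (+-assoc (if incident x v then w 0 else 0) _ _))

length-concat-applyUpTo : ∀ {L} (B : ℕ → List (ℕ × ℕ)) → (∀ i → length (B i) ≡ L) →
                          ∀ n → length (concat (applyUpTo B n)) ≡ n * L
length-concat-applyUpTo B length-B zero    = refl
length-concat-applyUpTo B length-B (suc n) =
  trans (length-++ (B 0)) (cong₂ _+_ (length-B 0) (length-concat-applyUpTo (B ∘ suc) (length-B ∘ suc) n))

incidenceSum-concat-applyUpTo : ∀ {L} (B : ℕ → List (ℕ × ℕ)) → (∀ i → length (B i) ≡ L) → ∀ n w v →
  incidenceSum (concat (applyUpTo B n)) w v ≡ ∑[ i < n ] incidenceSum (B i) (λ k → w (i * L + k)) v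
incidenceSum-concat-applyUpTo         B length-B zero    w v = refl
incidenceSum-concat-applyUpTo {L = L} B length-B (suc n) w v = begin
  incidenceSum (B 0 ++ concat (applyUpTo (B ∘ suc) n)) w v
    ≡⟨ incidenceSum-++ (B 0) _ w v ⟩
  incidenceSum (B 0) w v + incidenceSum (concat (applyUpTo (B ∘ suc) n)) (λ k → w (length (B 0) + k)) v
    ≡⟨ cong (_ +_) (incidenceSum-concat-applyUpTo (B ∘ suc) (length-B ∘ suc) n _ v) ⟩
  incidenceSum (B 0) w v + (∑[ i < n ] incidenceSum (B (suc i)) (λ k → w (length (B 0) + (i * L + k))) v)
    ≡⟨ cong (_ +_) (∑-cong n λ {i} _ → incidenceSum-cong (B (suc i)) v λ {k} _ → cong w (shift i k)) ⟩
  incidenceSum (B 0) w v + (∑[ i < n ] incidenceSum (B (suc i)) (λ k → w (suc i * L + k)) v)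
    ∎
  where
  shift : ∀ i k → length (B 0) + (i * L + k) ≡ suc i * L + k
  shift i k = trans (cong (_+ (i * L + k)) (length-B 0)) (sym (+-assoc L (i * L) k))

concatMap-upTo : ∀ (F : ℕ → List (ℕ × ℕ)) n → concatMap F (upTo n) ≡ concat (applyUpTo F n)
concatMap-upTo F n = cong concat (map-applyUpTo (λ i → i) F n)

All-concatMap-upTo : ∀ {P : ℕ × ℕ → Set} (F : ℕ → List (ℕ × ℕ)) n → (∀ {i} → i < n → All P (F i)) →
                     All P (concatMap F (upTo n))
All-concatMap-upTo F n all-F = All.concat⁺ (All.map⁺ (All.applyUpTo⁺₁ (λ i → i) n all-F))

mapEdge : (ℕ → ℕ) → ℕ × ℕ → ℕ × ℕ
mapEdge P e = P (proj₁ e) , P (proj₂ e)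

incidenceSum-mapEdge : ∀ (P : ℕ → ℕ) V es w v →
  All (λ e → proj₁ e < V × proj₂ e < V × P (proj₁ e) ≢ P (proj₂ e)) es →
  incidenceSum (map (mapEdge P) es) w v ≡ ∑[ x < V ] δ (P x) v * incidenceSum es w x
incidenceSum-mapEdge P V []             w v [] =
  sym (trans (∑-cong V λ {x} _ → *-zeroʳ (δ (P x) v)) (∑-zero V))
incidenceSum-mapEdge P V ((a , b) ∷ es) w v ((a<V , b<V , Pa≢Pb) ∷ separated) = begin
  (if incident (P a , P b) v then w 0 else 0) + incidenceSum (map (mapEdge P) es) (w ∘ suc) v
    ≡⟨ cong₂ _+_ (incident-δ v (w 0) Pa≢Pb) (incidenceSum-mapEdge P V es (w ∘ suc) v separated) ⟩
  (δ (P a) v + δ (P b) v) * w 0 + (∑[ x < V ] δ (P x) v * rest x)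
    ≡⟨ cong (_+ (∑[ x < V ] δ (P x) v * rest x)) endpoints ⟨
  (∑[ x < V ] δ (P x) v * ((δ a x + δ b x) * w 0)) + (∑[ x < V ] δ (P x) v * rest x)
    ≡⟨ ∑-distrib-+ V _ _ ⟨
  (∑[ x < V ] (δ (P x) v * ((δ a x + δ b x) * w 0) + δ (P x) v * rest x))
    ≡⟨ ∑-cong V (λ {x} _ → trans (sym (*-distribˡ-+ (δ (P x) v) _ _))
                                 (cong (λ t → δ (P x) v * (t + rest x))
                                       (sym (incident-δ x (w 0) (Pa≢Pb ∘ cong P))))) ⟩
  (∑[ x < V ] δ (P x) v * ((if incident (a , b) x then w 0 else 0) + rest x))
    ∎
  where
  rest : ℕ → ℕ
  rest = incidenceSum es (w ∘ suc)
  g : ℕ → ℕ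
  g x = δ (P x) v * w 0
  spread : ∀ p s t c → p * ((s + t) * c) ≡ s * (p * c) + t * (p * c)
  spread = solve-∀
  endpoints : ∑[ x < V ] δ (P x) v * ((δ a x + δ b x) * w 0) ≡ (δ (P a) v + δ (P b) v) * w 0
  endpoints = begin
    (∑[ x < V ] δ (P x) v * ((δ a x + δ b x) * w 0))
      ≡⟨ ∑-cong V (λ {x} _ → trans (spread (δ (P x) v) (δ a x) (δ b x) (w 0))
                                   (cong₂ (λ s t → s * g x + t * g x) (δ-sym a x) (δ-sym b x))) ⟩
    (∑[ x < V ] (δ x a * g x + δ x b * g x))             ≡⟨ ∑-distrib-+ V _ _ ⟩
    (∑[ x < V ] δ x a * g x) + (∑[ x < V ] δ x b * g x)  ≡⟨ cong₂ _+_ (∑-δ a<V g) (∑-δ b<V g) ⟩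
    g a + g b                                            ≡⟨ *-distribʳ-+ (w 0) (δ (P a) v) (δ (P b) v) ⟨
    (δ (P a) v + δ (P b) v) * w 0                        ∎

-- Counting colours

∈-─ : ∀ {A : Set} {x y : A} {ys} (y∈ys : y ∈ ys) → x ∈ ys → x ≢ y → x ∈ (ys ─ y∈ys)
∈-─ (here refl) (here refl) x≢y = contradiction refl x≢y
∈-─ (here refl) (there x∈)  _   = x∈
∈-─ (there y∈)  (here refl) _   = here refl
∈-─ (there y∈)  (there x∈)  x≢y = there (∈-─ y∈ x∈ x≢y)

Unique-⊆⇒length-≤ : ∀ {A : Set} {xs ys : List A} → Unique xs → xs ⊆ ys → length xs ≤ length ys
Unique-⊆⇒length-≤ {xs = []}     _               _       = z≤n
Unique-⊆⇒length-≤ {xs = x ∷ xs} {ys} (x∉xs ∷ unique) x∷xs⊆ys =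
  subst (suc (length xs) ≤_) (sym (length-removeAt′ ys _))
        (s≤s (Unique-⊆⇒length-≤ unique λ y∈xs →
          ∈-─ x∈ys (x∷xs⊆ys (there y∈xs)) (≢-sym (All.lookup x∉xs y∈xs))))
  where
  x∈ys : x ∈ ys
  x∈ys = x∷xs⊆ys (here refl)

numColors-≤ : ∀ G f (palette : List ℕ) → (∀ {v} → v < nV G → vsum G f v ∈ palette) →
              numColors G f ≤ length palette
numColors-≤ G f palette sum∈palette = Unique-⊆⇒length-≤ (deduplicate-! _) λ c∈ →
  attained (∈-map⁻ (vsum G f) (∈-deduplicate⁻ _≟_ _ c∈))
  where
  attained : ∀ {c} → ∃ (λ v → v ∈ upTo (nV G) × c ≡ vsum G f v) → c ∈ palette
  attained (v , v∈ , refl) = sum∈palette (∈-upTo⁻ v∈)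

numColors-≥ : ∀ G f (vs : List ℕ) → All (_< nV G) vs → Unique (map (vsum G f) vs) →
              length vs ≤ numColors G f
numColors-≥ G f vs vs<nV unique = subst (_≤ numColors G f) (length-map (vsum G f) vs)
  (Unique-⊆⇒length-≤ unique (attained ∘ ∈-map⁻ (vsum G f)))
  where
  attained : ∀ {c} → ∃ (λ v → v ∈ vs × c ≡ vsum G f v) →
             c ∈ deduplicate _≟_ (map (vsum G f) (upTo (nV G)))
  attained (v , v∈vs , refl) = ∈-deduplicate⁺ _≟_ (∈-map⁺ (vsum G f) (∈-upTo⁺ (All.lookup vs<nV v∈vs)))

injective⇒surjective : ∀ {n} (f : Fin n → Fin n) → Injective _≡_ _≡_ f → Surjective _≡_ _≡_ f
injective⇒surjective {zero}  f f-inj ()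
injective⇒surjective {suc n} f f-inj = strictlySurjective⇒surjective hit
  where
  hit : ∀ y → ∃ λ x → f x ≡ y
  hit y with any? (λ x → f x ≟ᶠ y)
  ... | yes found  = found
  ... | no  missed = contradiction (injective⇒≤ squeeze-injective) 1+n≰n
    where
    y≢f : ∀ x → y ≢ f x
    y≢f x y≡fx = missed (x , sym y≡fx)
    squeeze : Fin (suc n) → Fin n
    squeeze x = punchOut (y≢f x)
    squeeze-injective : Injective _≡_ _≡_ squeeze
    squeeze-injective = f-inj ∘ punchOut-injective (y≢f _) (y≢f _)

-- The labels of one copy of C(8,2)

bit : Bool → ℕ
bit false = 0
bit true  = 1

bit<2 : ∀ b → bit b < 2
bit<2 false = z<s
bit<2 true  = s<s z<s

bit-injective : ∀ {b b'} → bit b ≡ bit b' → b ≡ b'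
bit-injective {false} {false} _ = refl
bit-injective {true}  {true}  _ = refl

region : ℕ → ℕ
region 0 = 0
region 1 = 2
region 2 = 1
region 3 = 2
region 4 = 1
region 5 = 0
region 6 = 3
region 7 = 3
region _ = 4

upper : ℕ → Bool
upper 1 = true
upper 4 = true
upper 5 = true
upper 7 = true
upper 9 = true
upper _ = false

reversed : ℕ → Bool
reversed e = e % 2 ≡ᵇ 1

interlaced : ℕ → Bool
interlaced 1 = true
interlaced 2 = true
interlaced _ = false

slotAt : ℕ → Bool → ℕ
slotAt 0 false = 0
slotAt 0 true  = 5
slotAt 1 false = 2
slotAt 1 true  = 4
slotAt 2 false = 3
slotAt 2 true  = 1
slotAt 3 false = 6
slotAt 3 true  = 7
slotAt _ false = 8
slotAt _ true  = 9

slotAt-region-upper : ∀ {e} → e < 10 → slotAt (region e) (upper e) ≡ e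
slotAt-region-upper {0} _ = refl
slotAt-region-upper {1} _ = refl
slotAt-region-upper {2} _ = refl
slotAt-region-upper {3} _ = refl
slotAt-region-upper {4} _ = refl
slotAt-region-upper {5} _ = refl
slotAt-region-upper {6} _ = refl
slotAt-region-upper {7} _ = refl
slotAt-region-upper {8} _ = refl
slotAt-region-upper {9} _ = refl
slotAt-region-upper {suc (suc (suc (suc (suc (suc (suc (suc (suc (suc e)))))))))} e<10 =
  contradiction e<10 (m+n≮m 10 e)

region<5 : ∀ e → region e < 5
region<5 0 = <ᵇ⇒< _ _ _
region<5 1 = <ᵇ⇒< _ _ _
region<5 2 = <ᵇ⇒< _ _ _
region<5 3 = <ᵇ⇒< _ _ _
region<5 4 = <ᵇ⇒< _ _ _
region<5 5 = <ᵇ⇒< _ _ _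
region<5 6 = <ᵇ⇒< _ _ _
region<5 7 = <ᵇ⇒< _ _ _
region<5 (suc (suc (suc (suc (suc (suc (suc (suc e)))))))) = <ᵇ⇒< _ _ _

offset : Bool → Bool → ℕ → ℕ → ℕ
offset true  u     p N = bit u + p * 2
offset false false p N = p
offset false true  p N = N + p

offset-halves : ∀ u p N → offset false u p N ≡ p + bit u * N
offset-halves false p N = sym (+-identityʳ p)
offset-halves true  p N = trans (+-comm N p) (cong (p +_) (sym (+-identityʳ N)))

offset-< : ∀ i u {p N} → p < N → offset i u p N < 2 * N
offset-< true  u {p} {N} p<N = subst (bit u + p * 2 <_) (*-comm N 2) (digits-< (bit<2 u) p<N)
offset-< false u {p} {N} p<N = subst (_< 2 * N) (sym (offset-halves u p N)) (digits-< p<N (bit<2 u))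

offset-injective : ∀ i {u u' p p' N} → p < N → p' < N →
                   offset i u p N ≡ offset i u' p' N → u ≡ u' × p ≡ p'
offset-injective true  {u} {u'} p<N p'<N eq =
  let bit≡ , p≡ = digits-unique (bit<2 u) (bit<2 u') eq in bit-injective bit≡ , p≡
offset-injective false {u} {u'} {p} {p'} {N} p<N p'<N eq =
  let p≡ , bit≡ = digits-unique p<N p'<N
                    (trans (sym (offset-halves u p N)) (trans eq (offset-halves u' p' N)))
  in bit-injective bit≡ , p≡

position : ℕ → ℕ → ℕ → ℕ
position q d e = if reversed e then d else q

position-< : ∀ {N q} e → q < N → position q (N ∸ suc q) e < N
position-< e q<N with reversed e
... | true  = ∸-monoʳ-< z<s q<N
... | false = q<N

position-injective : ∀ {N q q'} e → q < N → q' < N →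
                     position q (N ∸ suc q) e ≡ position q' (N ∸ suc q') e → q ≡ q'
position-injective e q<N q'<N eq with reversed e
... | true  = suc-injective (∸-cancelˡ-≡ q<N q'<N eq)
... | false = eq

slotOffset : ℕ → ℕ → ℕ → ℕ → ℕ
slotOffset N q d e = offset (interlaced (region e)) (upper e) (position q d e) N

-- Labels are 0-based (the edge gets slotLabel + 1).  The ten slots pair up in the five blocks
-- [2N·b, 2N·(b + 1)) with b = region e: an interlaced block holds its two slots on its even and
-- odd labels, any other block in its lower and upper half, and a reversed slot runs through its
-- labels with d = N - 1 - q in place of q.
slotLabel : ℕ → ℕ → ℕ → ℕ → ℕ
slotLabel N q d e = region e * (2 * N) + slotOffset N q d e

slotOffset-< : ∀ {N q} e → q < N → slotOffset N q (N ∸ suc q) e < 2 * N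
slotOffset-< e q<N = offset-< (interlaced (region e)) (upper e) (position-< e q<N)

slotLabel-< : ∀ {N q} e → q < N → slotLabel N q (N ∸ suc q) e < N * 10
slotLabel-< {N} {q} e q<N =
  subst₂ _<_ (+-comm (slotOffset N q (N ∸ suc q) e) _) (ten N) (digits-< (slotOffset-< e q<N) (region<5 e))
  where
  ten : ∀ N → 5 * (2 * N) ≡ N * 10
  ten = solve-∀

slotLabel-injective : ∀ {N q q' e e'} → q < N → q' < N → e < 10 → e' < 10 →
  slotLabel N q (N ∸ suc q) e ≡ slotLabel N q' (N ∸ suc q') e' → q ≡ q' × e ≡ e'
slotLabel-injective {N} {q} {q'} {e} {e'} q<N q'<N e<10 e'<10 eq = same-slot e≡e'
  where
  o o' : ℕ
  o  = slotOffset N q (N ∸ suc q) e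
  o' = slotOffset N q' (N ∸ suc q') e'
  split : o ≡ o' × region e ≡ region e'
  split = digits-unique {p = region e} {q = region e'} (slotOffset-< e q<N) (slotOffset-< e' q'<N)
                        (trans (+-comm o _) (trans eq (+-comm _ o')))
  offset≡ : o ≡ offset (interlaced (region e)) (upper e') (position q' (N ∸ suc q') e') N
  offset≡ = subst (λ r → o ≡ offset (interlaced r) (upper e') (position q' (N ∸ suc q') e') N)
                  (sym (proj₂ split)) (proj₁ split)
  upper-position≡ : upper e ≡ upper e' × position q (N ∸ suc q) e ≡ position q' (N ∸ suc q') e'
  upper-position≡ = offset-injective (interlaced (region e)) (position-< e q<N) (position-< e' q'<N) offset≡
  e≡e' : e ≡ e'
  e≡e' = trans (sym (slotAt-region-upper e<10))
               (trans (cong₂ slotAt (proj₂ split) (proj₁ upper-position≡)) (slotAt-region-upper e'<10))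
  same-slot : e ≡ e' → q ≡ q' × e ≡ e'
  same-slot refl = position-injective e q<N q'<N (proj₂ upper-position≡) , refl

-- Edge k of rG(8,2) is edge k % 10 of copy k / 10 (see E-copies below).
edgeLabel : ℕ → ℕ → ℕ
edgeLabel N k = slotLabel N (k / 10) (N ∸ suc (k / 10)) (k % 10)

edgeLabel-slot : ∀ N {e} Q → e < 10 → edgeLabel N (e + Q * 10) ≡ slotLabel N Q (N ∸ suc Q) e
edgeLabel-slot N Q e<10 with digits-divMod Q e<10
... | e≡ , Q≡ rewrite e≡ | Q≡ = refl

edgeLabel-< : ∀ {N k} → k < N * 10 → edgeLabel N k < N * 10
edgeLabel-< {N} {k} k<10N = slotLabel-< (k % 10) (m<n*o⇒m/o<n k<10N)

edgeLabel-injective : ∀ {N k k'} → k < N * 10 → k' < N * 10 → edgeLabel N k ≡ edgeLabel N k' → k ≡ k'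
edgeLabel-injective {N} {k} {k'} k< k'< eq =
  let Q≡ , e≡ = slotLabel-injective (m<n*o⇒m/o<n k<) (m<n*o⇒m/o<n k'<) (m%n<n k 10) (m%n<n k' 10) eq
  in trans (m≡m%n+[m/n]*n k 10) (trans (cong₂ (λ e Q → e + Q * 10) e≡ Q≡) (sym (m≡m%n+[m/n]*n k' 10)))

localSum : ℕ → ℕ → ℕ
localSum N 0 = 32 * N + 2
localSum N 2 = 14 * N + 2
localSum N 4 = 8 * N
localSum N 6 = 14 * N + 2
localSum N _ = 8 * N + 1

-- The left-hand sides are incidenceSum C82-edges at z, u1, ..., u7 unfolded; each trailing + 0 is
-- the empty tail of incidenceSum.
sum-at-z : ∀ q d → let N = q + suc d in
  suc (3 * (2 * N) + q) + (suc (3 * (2 * N) + (N + d)) + (suc (4 * (2 * N) + q) + (suc (4 * (2 * N) + (N + d)) + 0)))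
    ≡ 32 * N + 2
sum-at-z = solve-∀

sum-at-u1 : ∀ q d → let N = q + suc d in suc q + (suc (3 * (2 * N) + (N + d)) + 0) ≡ 8 * N + 1
sum-at-u1 = solve-∀

sum-at-u2 : ∀ q d → let N = q + suc d in
  suc q + (suc (2 * (2 * N) + suc (d * 2)) + (suc (4 * (2 * N) + q) + 0)) ≡ 14 * N + 2
sum-at-u2 = solve-∀

sum-at-u3 : ∀ q d → let N = q + suc d in
  suc (2 * (2 * N) + suc (d * 2)) + (suc (1 * (2 * N) + q * 2) + 0) ≡ 8 * N + 1
sum-at-u3 = solve-∀

sum-at-u4 : ∀ q d → let N = q + suc d in
  suc (1 * (2 * N) + q * 2) + (suc (2 * (2 * N) + d * 2) + 0) ≡ 8 * N
sum-at-u4 = solve-∀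

sum-at-u5 : ∀ q d → let N = q + suc d in
  suc (2 * (2 * N) + d * 2) + (suc (1 * (2 * N) + suc (q * 2)) + 0) ≡ 8 * N + 1
sum-at-u5 = solve-∀

sum-at-u6 : ∀ q d → let N = q + suc d in
  suc (1 * (2 * N) + suc (q * 2)) + (suc (N + d) + (suc (4 * (2 * N) + (N + d)) + 0)) ≡ 14 * N + 2
sum-at-u6 = solve-∀

sum-at-u7 : ∀ q d → let N = q + suc d in suc (N + d) + (suc (3 * (2 * N) + q) + 0) ≡ 8 * N + 1
sum-at-u7 = solve-∀

incidenceSum-slotLabel′ : ∀ q d {x} → x < 8 →
  incidenceSum C82-edges (λ k → suc (slotLabel (q + suc d) q d k)) x ≡ localSum (q + suc d) x
incidenceSum-slotLabel′ q d {0} _ = sum-at-z q d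
incidenceSum-slotLabel′ q d {1} _ = sum-at-u1 q d
incidenceSum-slotLabel′ q d {2} _ = sum-at-u2 q d
incidenceSum-slotLabel′ q d {3} _ = sum-at-u3 q d
incidenceSum-slotLabel′ q d {4} _ = sum-at-u4 q d
incidenceSum-slotLabel′ q d {5} _ = sum-at-u5 q d
incidenceSum-slotLabel′ q d {6} _ = sum-at-u6 q d
incidenceSum-slotLabel′ q d {7} _ = sum-at-u7 q d
incidenceSum-slotLabel′ q d {suc (suc (suc (suc (suc (suc (suc (suc x)))))))} x<8 =
  contradiction x<8 (m+n≮m 8 x)

incidenceSum-slotLabel : ∀ {N q x} → q < N → x < 8 →
  incidenceSum C82-edges (λ k → suc (slotLabel N q (N ∸ suc q) k)) x ≡ localSum N x
incidenceSum-slotLabel {N} {q} {x} q<N x<8 =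
  subst (λ M → incidenceSum C82-edges (λ k → suc (slotLabel M q (N ∸ suc q) k)) x ≡ localSum M x)
        (trans (+-suc q _) (m+[n∸m]≡n q<N)) (incidenceSum-slotLabel′ q (N ∸ suc q) x<8)

-- The graph rG(8,2)

residue : ℕ → ℕ
residue 0       = 3
residue (suc t) = t

residue<7 : ∀ {x} → x < 8 → residue x < 7
residue<7 {0}     _         = <ᵇ⇒< 3 7 _
residue<7 {suc t} (s<s t<7) = t<7

colour : ℕ → ℕ → ℕ
colour N 1 = 14 * N + 2
colour N 3 = 40 * N + 2
colour N 5 = 14 * N + 2
colour N _ = 8 * N + 1

palette : ℕ → List ℕ
palette N = 8 * N + 1 ∷ 14 * N + 2 ∷ 40 * N + 2 ∷ []

colour∈palette : ∀ N R → colour N R ∈ palette N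
colour∈palette N 0 = here refl
colour∈palette N 1 = there (here refl)
colour∈palette N 2 = here refl
colour∈palette N 3 = there (there (here refl))
colour∈palette N 4 = here refl
colour∈palette N 5 = there (here refl)
colour∈palette N (suc (suc (suc (suc (suc (suc R)))))) = here refl

∑-residue : ∀ {R} → R < 7 → (f : ℕ → ℕ) → ∑[ x < 8 ] δ (residue x) R * f x ≡ f (suc R) + δ 3 R * f 0
∑-residue {R} R<7 f =
  trans (cong (δ 3 R * f 0 +_) (∑-δ R<7 (f ∘ suc))) (+-comm (δ 3 R * f 0) (f (suc R)))

merged-colour : ∀ N {R} → R < 7 → localSum N (suc R) + δ 3 R * localSum N 0 ≡ colour N R
merged-colour N {0} _ = +-identityʳ _
merged-colour N {1} _ = +-identityʳ _
merged-colour N {2} _ = +-identityʳ _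
merged-colour N {3} _ = u4+z N
  where
  u4+z : ∀ N → 8 * N + ((32 * N + 2) + 0) ≡ 40 * N + 2
  u4+z = solve-∀
merged-colour N {4} _ = +-identityʳ _
merged-colour N {5} _ = +-identityʳ _
merged-colour N {6} _ = +-identityʳ _
merged-colour N {suc (suc (suc (suc (suc (suc (suc R)))))) } R<7 = contradiction R<7 (m+n≮m 7 R)

C82-residues : All (λ e → proj₁ e < 8 × proj₂ e < 8 × residue (proj₁ e) ≢ residue (proj₂ e)) C82-edges
C82-residues =
  from-yes (all? (λ e → proj₁ e <? 8 ×-dec proj₂ e <? 8 ×-dec ¬? (residue (proj₁ e) ≟ residue (proj₂ e))) C82-edges)

C82-coloured : ∀ {N} → 1 ≤ N →
               All (λ e → colour N (residue (proj₁ e)) ≢ colour N (residue (proj₂ e))) C82-edges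
C82-coloured {N} 1≤N =
  B≢C ∷ ≢-sym B≢C ∷ B≢A ∷ ≢-sym B≢A ∷ B≢C ∷ ≢-sym B≢C ∷ B≢A ∷ ≢-sym B≢A ∷ ≢-sym C≢A ∷ ≢-sym C≢A ∷ []
  where
  B≢C : 8 * N + 1 ≢ 14 * N + 2
  B≢C = <⇒≢ (+-mono-≤-< (*-monoˡ-≤ N (≤ᵇ⇒≤ 8 14 _)) (<ᵇ⇒< 1 2 _))
  B≢A : 8 * N + 1 ≢ 40 * N + 2
  B≢A = <⇒≢ (+-mono-≤-< (*-monoˡ-≤ N (≤ᵇ⇒≤ 8 40 _)) (<ᵇ⇒< 1 2 _))
  C≢A : 14 * N + 2 ≢ 40 * N + 2
  C≢A = <⇒≢ (+-monoˡ-< 2 (*-monoˡ-< N {{>-nonZero 1≤N}} (<ᵇ⇒< 14 40 _)))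

2*h≡h+h : ∀ h → 2 * h ≡ h + h
2*h≡h+h h = cong (h +_) (+-identityʳ h)

partner-< : ∀ {h j} → j < h → partner h j ≡ j + h
partner-< {h} {j} j<h with j <ᵇ h | <⇒<ᵇ j<h
... | true | _ = refl

partner-+ : ∀ h i → partner h (h + i) ≡ i
partner-+ h i with (h + i) <ᵇ h in h+i<h
... | true  = contradiction (<ᵇ⇒< (h + i) h (subst T (sym h+i<h) _)) (m+n≮m h i)
... | false = m+n∸m≡n h i

partner-<2h : ∀ {h j} → j < 2 * h → partner h j < 2 * h
partner-<2h {h} {j} j<2h with j <ᵇ h in j<h
... | true  = subst (j + h <_) (sym (2*h≡h+h h)) (+-monoˡ-< h (<ᵇ⇒< j h (subst T (sym j<h) _)))
... | false = ≤-<-trans (m∸n≤m j h) j<2h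

∑-partner : ∀ h (f : ℕ → ℕ) → ∑[ j < 2 * h ] f (partner h j) ≡ ∑< (2 * h) f
∑-partner h f = begin
  (∑[ j < 2 * h ] f (partner h j))
    ≡⟨ cong (λ n → ∑[ j < n ] f (partner h j)) (2*h≡h+h h) ⟩
  (∑[ j < h + h ] f (partner h j))
    ≡⟨ ∑-++ h h _ ⟩
  (∑[ j < h ] f (partner h j)) + (∑[ i < h ] f (partner h (h + i)))
    ≡⟨ cong₂ _+_ (∑-cong h λ {j} j<h → cong f (trans (partner-< j<h) (+-comm j h)))
                 (∑-cong h λ {i} _ → cong f (partner-+ h i)) ⟩
  (∑[ j < h ] f (h + j)) + ∑< h f
    ≡⟨ +-comm _ (∑< h f) ⟩
  ∑< h f + (∑[ j < h ] f (h + j))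
    ≡⟨ ∑-++ h h f ⟨
  ∑< (h + h) f
    ≡⟨ cong (λ n → ∑< n f) (2*h≡h+h h) ⟨
  ∑< (2 * h) f
    ∎

shift-place : ∀ c h p t → c * (7 * (2 * h)) + (7 * p + t) ≡ t + (c * (2 * h) + p) * 7
shift-place = solve-∀

module Construction (r h : ℕ) where

  N : ℕ
  N = r * (2 * h)

  G : Graph
  G = copies r (G82 h)

  nV≡N*7 : nV G ≡ N * 7
  nV≡N*7 = rearrange r h
    where
    rearrange : ∀ r h → r * (7 * (2 * h)) ≡ r * (2 * h) * 7
    rearrange = solve-∀

  vertex : ℕ → ℕ → ℕ → ℕ
  vertex c j x = c * nV (G82 h) + G82-vertex h j x

  -- Vertex x of copy (c, j) is residue x + copyOf c j x * 7: u_t sits at position t - 1 of its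
  -- own copy c * 2h + j, and z at position 3 (the u4) of the partner copy.
  copyOf : ℕ → ℕ → ℕ → ℕ
  copyOf c j 0       = c * (2 * h) + partner h j
  copyOf c j (suc t) = c * (2 * h) + j

  vertex-digits : ∀ c j x → vertex c j x ≡ residue x + copyOf c j x * 7
  vertex-digits c j 0       = shift-place c h (partner h j) 3
  vertex-digits c j (suc t) = shift-place c h j t

  copy-< : ∀ {c j} → c < r → j < 2 * h → c * (2 * h) + j < N
  copy-< {c} {j} c<r j<2h = subst (_< N) (+-comm j _) (digits-< j<2h c<r)

  copyOf-< : ∀ {c j} x → c < r → j < 2 * h → copyOf c j x < N
  copyOf-< 0       c<r j<2h = copy-< c<r (partner-<2h {h} j<2h)
  copyOf-< (suc t) c<r j<2h = copy-< c<r j<2h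

  vertex-< : ∀ {c j x} → c < r → j < 2 * h → x < 8 → vertex c j x < nV G
  vertex-< {c} {j} {x} c<r j<2h x<8 =
    subst₂ _<_ (sym (vertex-digits c j x)) (sym nV≡N*7) (digits-< (residue<7 x<8) (copyOf-< x c<r j<2h))

  vertex-separates : ∀ c j →
    All (λ e → proj₁ e < 8 × proj₂ e < 8 × vertex c j (proj₁ e) ≢ vertex c j (proj₂ e)) C82-edges
  vertex-separates c j = All.map separate C82-residues
    where
    separate : ∀ {e} → proj₁ e < 8 × proj₂ e < 8 × residue (proj₁ e) ≢ residue (proj₂ e) →
               proj₁ e < 8 × proj₂ e < 8 × vertex c j (proj₁ e) ≢ vertex c j (proj₂ e)
    separate {a , b} (a<8 , b<8 , a≢b) = a<8 , b<8 , λ eq → a≢b (proj₁ (digits-unique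
      {p = copyOf c j a} {q = copyOf c j b} (residue<7 a<8) (residue<7 b<8)
      (trans (sym (vertex-digits c j a)) (trans eq (vertex-digits c j b)))))

  copyEdges : ℕ → ℕ → List (ℕ × ℕ)
  copyEdges c j = map (mapEdge (vertex c j)) C82-edges

  E-copies : E G ≡ concatMap (λ c → concatMap (copyEdges c) (upTo (2 * h))) (upTo r)
  E-copies = concatMap-cong (λ c → trans (map-concatMap (shift c) placed (upTo (2 * h)))
                                         (concatMap-cong (fuse c) (upTo (2 * h)))) (upTo r)
    where
    shift : ℕ → ℕ × ℕ → ℕ × ℕ
    shift c e = c * nV (G82 h) + proj₁ e , c * nV (G82 h) + proj₂ e
    placed : ℕ → List (ℕ × ℕ)
    placed j = map (mapEdge (G82-vertex h j)) C82-edges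
    fuse : ∀ c j → map (shift c) (placed j) ≡ copyEdges c j
    fuse c j = sym (map-∘ {g = shift c} {f = mapEdge (G82-vertex h j)} C82-edges)

  length-copies : ∀ c → length (concatMap (copyEdges c) (upTo (2 * h))) ≡ 2 * h * 10
  length-copies c = trans (cong length (concatMap-upTo (copyEdges c) (2 * h)))
                          (length-concat-applyUpTo (copyEdges c) (λ _ → refl) (2 * h))

  nE≡N*10 : nE G ≡ N * 10
  nE≡N*10 = begin
    length (E G)                     ≡⟨ cong length (trans E-copies (concatMap-upTo _ r)) ⟩
    length (concat (applyUpTo _ r))  ≡⟨ length-concat-applyUpTo _ length-copies r ⟩
    r * (2 * h * 10)                 ≡⟨ *-assoc r (2 * h) 10 ⟨
    N * 10                           ∎

  index<N*10 : (i : Fin (nE G)) → toℕ i < N * 10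
  index<N*10 i = subst (toℕ i <_) nE≡N*10 (toℕ<n i)

  relabel : Fin (nE G) → Fin (nE G)
  relabel i = fromℕ< (subst (edgeLabel N (toℕ i) <_) (sym nE≡N*10) (edgeLabel-< (index<N*10 i)))

  toℕ-relabel : ∀ i → toℕ (relabel i) ≡ edgeLabel N (toℕ i)
  toℕ-relabel i = toℕ-fromℕ< _

  relabel-injective : Injective _≡_ _≡_ relabel
  relabel-injective {i} {i'} eq = toℕ-injective (edgeLabel-injective (index<N*10 i) (index<N*10 i')
    (trans (sym (toℕ-relabel i)) (trans (cong toℕ eq) (toℕ-relabel i'))))

  labeling : Labeling G
  labeling = mk⤖ (relabel-injective , injective⇒surjective relabel relabel-injective)

  weight : ℕ → ℕ
  weight k = suc (edgeLabel N k)

  copyWeight : ℕ → ℕ → ℕ → ℕ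
  copyWeight c j k = weight (c * (2 * h * 10) + (j * 10 + k))

  incidenceSum-copy : ∀ {c j x} → c < r → j < 2 * h → x < 8 →
                      incidenceSum C82-edges (copyWeight c j) x ≡ localSum N x
  incidenceSum-copy {c} {j} {x} c<r j<2h x<8 = trans
    (incidenceSum-cong C82-edges x λ {k} k<10 →
      cong suc (trans (cong (edgeLabel N) (index c h j k)) (edgeLabel-slot N (c * (2 * h) + j) k<10)))
    (incidenceSum-slotLabel (copy-< c<r j<2h) x<8)
    where
    index : ∀ c h j k → c * (2 * h * 10) + (j * 10 + k) ≡ k + (c * (2 * h) + j) * 10
    index = solve-∀

  vsum-copies : ∀ v →
    vsum G labeling v ≡ ∑[ c < r ] ∑[ j < 2 * h ] ∑[ x < 8 ] δ (vertex c j x) v * localSum N x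
  vsum-copies v = begin
    vsum G labeling v
      ≡⟨ vsum≡incidenceSum G labeling weight (cong suc ∘ toℕ-relabel) v ⟩
    incidenceSum (E G) weight v
      ≡⟨ cong (λ es → incidenceSum es weight v) (trans E-copies (concatMap-upTo _ r)) ⟩
    incidenceSum (concat (applyUpTo _ r)) weight v
      ≡⟨ incidenceSum-concat-applyUpTo _ length-copies r weight v ⟩
    (∑[ c < r ] incidenceSum (concatMap (copyEdges c) (upTo (2 * h))) (λ k → weight (c * (2 * h * 10) + k)) v)
      ≡⟨ ∑-cong r (λ {c} _ → expand c) ⟩
    (∑[ c < r ] ∑[ j < 2 * h ] incidenceSum (copyEdges c j) (copyWeight c j) v)
      ≡⟨ ∑-cong r (λ {c} _ → ∑-cong (2 * h) λ {j} _ →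
           incidenceSum-mapEdge (vertex c j) 8 C82-edges (copyWeight c j) v (vertex-separates c j)) ⟩
    (∑[ c < r ] ∑[ j < 2 * h ] ∑[ x < 8 ] δ (vertex c j x) v * incidenceSum C82-edges (copyWeight c j) x)
      ≡⟨ ∑-cong r (λ {c} c<r → ∑-cong (2 * h) λ {j} j<2h → ∑-cong 8 λ {x} x<8 →
           cong (δ (vertex c j x) v *_) (incidenceSum-copy c<r j<2h x<8)) ⟩
    (∑[ c < r ] ∑[ j < 2 * h ] ∑[ x < 8 ] δ (vertex c j x) v * localSum N x)
      ∎
    where
    expand : ∀ c → incidenceSum (concatMap (copyEdges c) (upTo (2 * h))) (λ k → weight (c * (2 * h * 10) + k)) v
                 ≡ ∑[ j < 2 * h ] incidenceSum (copyEdges c j) (copyWeight c j) v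
    expand c = trans (cong (λ es → incidenceSum es (λ k → weight (c * (2 * h * 10) + k)) v)
                           (concatMap-upTo (copyEdges c) (2 * h)))
                     (incidenceSum-concat-applyUpTo (copyEdges c) (λ _ → refl) (2 * h) _ v)

  copy-count : ∀ {Q} x → Q < N → ∑[ c < r ] ∑[ j < 2 * h ] δ (copyOf c j x) Q ≡ 1
  copy-count {Q} 0 Q<N = begin
    (∑[ c < r ] ∑[ j < 2 * h ] δ (c * (2 * h) + partner h j) Q)
      ≡⟨ ∑-cong r (λ {c} _ → ∑-partner h (λ j → δ (c * (2 * h) + j) Q)) ⟩
    (∑[ c < r ] ∑[ j < 2 * h ] δ (c * (2 * h) + j) Q)
      ≡⟨ ∑-flatten r (2 * h) (λ i → δ i Q) ⟩
    (∑[ i < N ] δ i Q)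
      ≡⟨ ∑-δ≡1 Q<N ⟩
    1 ∎
  copy-count {Q} (suc t) Q<N = trans (∑-flatten r (2 * h) (λ i → δ i Q)) (∑-δ≡1 Q<N)

  vertex-count : ∀ {Q R x} → Q < N → R < 7 → x < 8 →
                 ∑[ c < r ] ∑[ j < 2 * h ] δ (vertex c j x) (R + Q * 7) ≡ δ (residue x) R
  vertex-count {Q} {R} {x} Q<N R<7 x<8 = begin
    (∑[ c < r ] ∑[ j < 2 * h ] δ (vertex c j x) (R + Q * 7))
      ≡⟨ ∑-cong r (λ {c} _ → ∑-cong (2 * h) λ {j} _ →
           trans (cong (λ u → δ u (R + Q * 7)) (vertex-digits c j x))
                 (δ-digits (copyOf c j x) Q (residue<7 x<8) R<7)) ⟩
    (∑[ c < r ] ∑[ j < 2 * h ] δ (copyOf c j x) Q * δ (residue x) R)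
      ≡⟨ ∑-cong r (λ {c} _ → *-distribʳ-∑ (2 * h) (λ j → δ (copyOf c j x) Q) _) ⟨
    (∑[ c < r ] (∑[ j < 2 * h ] δ (copyOf c j x) Q) * δ (residue x) R)
      ≡⟨ *-distribʳ-∑ r _ _ ⟨
    (∑[ c < r ] ∑[ j < 2 * h ] δ (copyOf c j x) Q) * δ (residue x) R
      ≡⟨ cong (_* δ (residue x) R) (copy-count x Q<N) ⟩
    1 * δ (residue x) R
      ≡⟨ *-identityˡ _ ⟩
    δ (residue x) R
      ∎

  vsum-colour : ∀ {Q R} → Q < N → R < 7 → vsum G labeling (R + Q * 7) ≡ colour N R
  vsum-colour {Q} {R} Q<N R<7 = begin
    vsum G labeling (R + Q * 7)
      ≡⟨ vsum-copies (R + Q * 7) ⟩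
    (∑[ c < r ] ∑[ j < 2 * h ] ∑[ x < 8 ] δ (vertex c j x) (R + Q * 7) * localSum N x)
      ≡⟨ ∑∑∑-swap-factor r (2 * h) 8 (λ c j x → δ (vertex c j x) (R + Q * 7)) (localSum N) ⟩
    (∑[ x < 8 ] (∑[ c < r ] ∑[ j < 2 * h ] δ (vertex c j x) (R + Q * 7)) * localSum N x)
      ≡⟨ ∑-cong 8 (λ {x} x<8 → cong (_* localSum N x) (vertex-count Q<N R<7 x<8)) ⟩
    (∑[ x < 8 ] δ (residue x) R * localSum N x)
      ≡⟨ ∑-residue R<7 (localSum N) ⟩
    localSum N (suc R) + δ 3 R * localSum N 0
      ≡⟨ merged-colour N R<7 ⟩
    colour N R
      ∎

  vsum-vertex : ∀ {c j x} → c < r → j < 2 * h → x < 8 →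
                vsum G labeling (vertex c j x) ≡ colour N (residue x)
  vsum-vertex {c} {j} {x} c<r j<2h x<8 =
    trans (cong (vsum G labeling) (vertex-digits c j x)) (vsum-colour (copyOf-< x c<r j<2h) (residue<7 x<8))

  antimagic : 1 ≤ N → IsLocalAntimagic G labeling
  antimagic 1≤N i = All.lookup proper (∈-lookup i)
    where
    Proper : ℕ × ℕ → Set
    Proper e = vsum G labeling (proj₁ e) ≢ vsum G labeling (proj₂ e)
    copy-proper : ∀ {c j} → c < r → j < 2 * h → All Proper (copyEdges c j)
    copy-proper c<r j<2h = All.map⁺ (All.zipWith
      (λ ((a<8 , b<8 , _) , colours≢) →
         subst₂ _≢_ (sym (vsum-vertex c<r j<2h a<8)) (sym (vsum-vertex c<r j<2h b<8)) colours≢)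
      (C82-residues , C82-coloured 1≤N))
    proper : All Proper (E G)
    proper = subst (All Proper) (sym E-copies)
                   (All-concatMap-upTo _ r λ c<r → All-concatMap-upTo _ (2 * h) (copy-proper c<r))

  numColors≤3 : numColors G labeling ≤ 3
  numColors≤3 = numColors-≤ G labeling (palette N) λ {v} v<nV →
    subst (_∈ palette N) (sym (vsum-at v<nV)) (colour∈palette N (v % 7))
    where
    vsum-at : ∀ {v} → v < nV G → vsum G labeling v ≡ colour N (v % 7)
    vsum-at {v} v<nV = trans (cong (vsum G labeling) (m≡m%n+[m/n]*n v 7))
                             (vsum-colour (m<n*o⇒m/o<n (subst (v <_) nV≡N*7 v<nV)) (m%n<n v 7))

-- Edges 0, 7 and 8 of the first copy form the triangle u1 u2 z.
3≤numColors : ∀ r h f → IsLocalAntimagic (copies (suc r) (G82 (suc h))) f →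
              3 ≤ numColors (copies (suc r) (G82 (suc h))) f
3≤numColors r h f f-antimagic = numColors-≥ G f (u1 ∷ u2 ∷ z ∷ [])
  (vertex-< z<s z<s (<ᵇ⇒< 1 8 _) ∷ vertex-< z<s z<s (<ᵇ⇒< 2 8 _) ∷ vertex-< z<s z<s z<s ∷ [])
  ((f-antimagic (# 0) ∷ ≢-sym (f-antimagic (# 7)) ∷ []) ∷ (≢-sym (f-antimagic (# 8)) ∷ []) ∷ [] ∷ [])
  where
  open Construction (suc r) (suc h) using (G; vertex; vertex-<)
  u1 u2 z : ℕ
  u1 = vertex 0 0 1
  u2 = vertex 0 0 2
  z  = vertex 0 0 0

theorem4p6 : (r h : ℕ) → 1 ≤ r → 1 ≤ h → χla≡ (copies r (G82 h)) 3
theorem4p6 (suc r) (suc h) _ _ =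
  (labeling , antimagic z<s , ≤-antisym numColors≤3 (3≤numColors r h labeling (antimagic z<s))) , 3≤numColors r h
  where
  open Construction (suc r) (suc h)
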